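{- Let $q_1$ and $q_2$ be prime powers, each congruent to $1\pmod 4$, and let $\alpha_1,\alpha_2$ be primitive elements of $\operatorname{GF}(q_1)$ and $\operatorname{GF}(q_2)$, respectively. Suppose that $\frac{3q_1-q_2}{2} = u_4(q_1)u_4(q_2)+4v_4(\alpha_1)v_4(\alpha_2)$. Then $(u_4(q_2)+u_4(q_1))^2\leqslant 4q_1$ and $(v_4(\alpha_2)+v_4(\alpha_1))^2\leqslant q_1$.
   Context: For a prime power $q = p^r = 4n+1$, $u_4(q)$ is the unique integer with $u_4(q)\equiv 1\pmod 4$ such that $q = u_4(q)^2+4v^2$ for some integer $v$, and $\gcd(u_4(q),p)=1$ when $p\equiv 1\pmod 4$; for a primitive element $\alpha$ of $\operatorname{GF}(q)$, $v_4(\alpha)$ is an integer with $q = u_4(q)^2+4v_4(\alpha)^2$ whose sign is chosen so that $c_4(\alpha;1,1+2\mathfrak r_n) = (q+2u_4(q)-3-8v_4(\alpha)+4\mathfrak r_n)/16$, where $\mathfrak r_n = n \bmod 2$ and $c_4(\alpha;a,b)=|\{\alpha^k+1: k\equiv a\pmod 4\}\cap\{\alpha^k: k\equiv b\pmod 4\}|$. -}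

module Defs where

open import Level using (0ℓ)
open import Algebra.Bundles using (CommutativeRing)
open import Data.Nat as ℕ using (ℕ; zero; suc; _%_; _/_; _^_)
open import Data.Nat.Primality using (Prime)
open import Data.Nat.Coprimality using (Coprime)
open import Data.Fin using (Fin)
open import Data.Integer as ℤ using (ℤ; +_; ∣_∣)
open import Data.List using (List; upTo; filter; length)
open import Data.List.Relation.Unary.Any using (Any; any?)
open import Data.Product using (Σ; ∃; ∃-syntax; _×_; _,_)
open import Relation.Binary.PropositionalEquality using (_≡_)
open import Relation.Nullary using (¬_; Dec)
open import Relation.Nullary.Decidable using (_×-dec_)
open import Data.Nat.Properties using (_≟_)

IsPrimePower : ℕ → Set
IsPrimePower q = ∃[ p ] ∃[ r ] (Prime p × 1 ℕ.≤ r × q ≡ p ^ r)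

record FiniteField (q : ℕ) : Set₁ where
  field
    commRing : CommutativeRing 0ℓ 0ℓ
  open CommutativeRing commRing public hiding (ring)
  field
    _≈?_     : (x y : Carrier) → Dec (x ≈ y)
    1≉0      : ¬ (1# ≈ 0#)
    inverse  : ∀ x → ¬ (x ≈ 0#) → ∃[ y ] (x * y ≈ 1#)
    enum     : Fin q → Carrier
    enum-inj : ∀ i j → enum i ≈ enum j → i ≡ j
    enum-sur : ∀ x → ∃[ i ] (enum i ≈ x)

module _ {q : ℕ} (F : FiniteField q) where
  open FiniteField F

  pow : Carrier → ℕ → Carrier
  pow x zero    = 1#
  pow x (suc k) = x * pow x k

  IsPrimitive : Carrier → Set
  IsPrimitive α = ¬ (α ≈ 0#) × (∀ x → ¬ (x ≈ 0#) → ∃[ k ] (pow α k ≈ x))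

  -- c_4(α;a,b) = |{α^k+1 : k ≡ a (mod 4)} ∩ {α^k : k ≡ b (mod 4)}|.
  -- Since k ↦ α^k + 1 is injective on 0 ≤ k < q-1 for primitive α, this is
  -- the number of k < q-1 with k ≡ a (mod 4) such that α^k + 1 = α^j for
  -- some j < q-1 with j ≡ b (mod 4).
  c4 : Carrier → ℕ → ℕ → ℕ
  c4 α a b = length (filter (λ k → (k % 4 ≟ a % 4) ×-dec
                        any? (λ j → (j % 4 ≟ b % 4) ×-dec ((pow α k + 1#) ≈? pow α j))
                             (upTo (q ℕ.∸ 1)))
                     (upTo (q ℕ.∸ 1)))

IsU4 : ℕ → ℤ → Set
IsU4 q u = (u ℤ.% + 4 ≡ 1)
         × (∃[ v ] (+ q ≡ u ℤ.* u ℤ.+ + 4 ℤ.* (v ℤ.* v)))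
         × (∀ p r → Prime p → q ≡ p ^ r → p % 4 ≡ 1 → Coprime ∣ u ∣ p)

IsV4 : {q : ℕ} (F : FiniteField q) → FiniteField.Carrier F → ℤ → ℤ → Set
IsV4 {q} F α u v =
  (+ q ≡ u ℤ.* u ℤ.+ + 4 ℤ.* (v ℤ.* v))
  × (+ (16 ℕ.* c4 F α 1 (1 ℕ.+ 2 ℕ.* rn))
       ≡ + q ℤ.+ + 2 ℤ.* u ℤ.- + 3 ℤ.- + 8 ℤ.* v ℤ.+ + (4 ℕ.* rn))
  where
    rn : ℕ
    rn = ((q ℕ.∸ 1) / 4) % 2

{-# OPTIONS --safe #-}
module Submission where

-- Adding q₁ = u₁² + 4v₁² and q₂ = u₂² + 4v₂² to the hypothesis
-- 3q₁ − q₂ = 2(u₁u₂ + 4v₁v₂) gives (u₂ + u₁)² + 4(v₂ + v₁)² = 4q₁; as both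
-- summands on the left are nonnegative, each is at most 4q₁.

open import Defs
open import Data.Nat as ℕ using (ℕ; _%_)
open import Data.Integer using (ℤ; +_; -[1+_]; 0ℤ; _+_; _-_; _*_; _≤_; +≤+)
open import Data.Integer.Properties
  using (+-identityˡ; +-identityʳ; +-monoˡ-≤; +-monoʳ-≤; *-zeroʳ; *-monoˡ-≤-nonNeg; *-cancelˡ-≤-pos)
open import Data.Integer.Tactic.RingSolver using (solve-∀)
open import Data.Product using (_×_; _,_)
open import Relation.Binary.PropositionalEquality using (_≡_; cong; cong₂; subst; subst₂; module ≡-Reasoning)

square-nonNeg : ∀ i → 0ℤ ≤ i * i
square-nonNeg (+ ℕ.zero)  = +≤+ ℕ.z≤n
square-nonNeg (+ ℕ.suc n) = +≤+ ℕ.z≤n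
square-nonNeg -[1+ n ]    = +≤+ ℕ.z≤n

summands-≤-sum : ∀ {i j k} → 0ℤ ≤ i → 0ℤ ≤ j → i + j ≡ k → (i ≤ k) × (j ≤ k)
summands-≤-sum {i} {j} 0≤i 0≤j i+j≡k =
  subst₂ _≤_ (+-identityʳ i) i+j≡k (+-monoʳ-≤ i 0≤j) ,
  subst₂ _≤_ (+-identityˡ j) i+j≡k (+-monoˡ-≤ j 0≤i)

u²+4v²≡4q⇒bounds : ∀ u v q → u * u + + 4 * (v * v) ≡ + 4 * q → (u * u ≤ + 4 * q) × (v * v ≤ q)
u²+4v²≡4q⇒bounds u v q eq =
  let u²≤4q , 4v²≤4q = summands-≤-sum (square-nonNeg u) 0≤4v² eq
  in  u²≤4q , *-cancelˡ-≤-pos (v * v) q (+ 4) 4v²≤4q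
  where
  0≤4v² : 0ℤ ≤ + 4 * (v * v)
  0≤4v² = subst (_≤ + 4 * (v * v)) (*-zeroʳ (+ 4)) (*-monoˡ-≤-nonNeg (+ 4) (square-nonNeg v))

u²+4v²-of-sum : ∀ u₁ u₂ v₁ v₂ →
  (u₂ + u₁) * (u₂ + u₁) + + 4 * ((v₂ + v₁) * (v₂ + v₁))
    ≡ (u₁ * u₁ + + 4 * (v₁ * v₁)) + (u₂ * u₂ + + 4 * (v₂ * v₂)) + + 2 * (u₁ * u₂ + + 4 * (v₁ * v₂))
u²+4v²-of-sum = solve-∀

lemma4p15 : (q₁ q₂ : ℕ) → IsPrimePower q₁ → IsPrimePower q₂
    → q₁ % 4 ≡ 1 → q₂ % 4 ≡ 1
    → (F₁ : FiniteField q₁) (F₂ : FiniteField q₂)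
    → (α₁ : FiniteField.Carrier F₁) (α₂ : FiniteField.Carrier F₂)
    → IsPrimitive F₁ α₁ → IsPrimitive F₂ α₂
    → (u₁ u₂ v₁ v₂ : ℤ)
    → IsU4 q₁ u₁ → IsU4 q₂ u₂
    → IsV4 F₁ α₁ u₁ v₁ → IsV4 F₂ α₂ u₂ v₂
    → + 3 * + q₁ - + q₂ ≡ + 2 * (u₁ * u₂ + + 4 * (v₁ * v₂))
    → ((u₂ + u₁) * (u₂ + u₁) ≤ + 4 * + q₁) × ((v₂ + v₁) * (v₂ + v₁) ≤ + q₁)
lemma4p15 q₁ q₂ _ _ _ _ _ _ _ _ _ _ u₁ u₂ v₁ v₂ _ _ (q₁≡u₁²+4v₁² , _) (q₂≡u₂²+4v₂² , _) 3q₁-q₂≡cross =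
  u²+4v²≡4q⇒bounds (u₂ + u₁) (v₂ + v₁) (+ q₁) sum≡4q₁
  where
  open ≡-Reasoning

  cross : ℤ
  cross = + 2 * (u₁ * u₂ + + 4 * (v₁ * v₂))

  sum-with-difference : ∀ a b → a + b + (+ 3 * a - b) ≡ + 4 * a
  sum-with-difference = solve-∀

  sum≡4q₁ : (u₂ + u₁) * (u₂ + u₁) + + 4 * ((v₂ + v₁) * (v₂ + v₁)) ≡ + 4 * + q₁
  sum≡4q₁ = begin
    (u₂ + u₁) * (u₂ + u₁) + + 4 * ((v₂ + v₁) * (v₂ + v₁))      ≡⟨ u²+4v²-of-sum u₁ u₂ v₁ v₂ ⟩
    (u₁ * u₁ + + 4 * (v₁ * v₁)) + (u₂ * u₂ + + 4 * (v₂ * v₂)) + cross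
                                                                ≡⟨ cong₂ (λ a b → a + b + cross) q₁≡u₁²+4v₁² q₂≡u₂²+4v₂² ⟨
    + q₁ + + q₂ + cross                                         ≡⟨ cong (_+_ (+ q₁ + + q₂)) 3q₁-q₂≡cross ⟨
    + q₁ + + q₂ + (+ 3 * + q₁ - + q₂)                           ≡⟨ sum-with-difference (+ q₁) (+ q₂) ⟩
    + 4 * + q₁                                                  ∎
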